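{- Let $n\ge1$ and let $K$ be a pure $n$-simplicial complex. If there exists an $(n-1,n)$-walk sequence of finite length between two distinct $(n-1)$-simplices $\sigma,\sigma'$ of $K$, then there exists a reduced $(n-1,n)$-path sequence between $\sigma$ and $\sigma'$.
   Context: A simplicial complex on a finite vertex set is a collection of non-empty vertex subsets containing all singletons and closed under non-empty subsets; a $k$-simplex has $k+1$ vertices; $\tau$ is a face of $\sigma$ if $\tau\subseteq\sigma$. $K$ is a pure $n$-simplicial complex if $\dim K=n$ and every simplex is a face of some $n$-simplex. Let $0\le m\le n-1$. An $(m,n)$-walk sequence between $m$-simplices $\sigma,\sigma'$ is an alternating sequence $\sigma=\sigma_1,\eta_1,\sigma_2,\dots,\sigma_r,\eta_r,\sigma_{r+1}=\sigma'$ of $m$-simplices $\sigma_k$ and $n$-simplices $\eta_k$ of $K$ with $\sigma_k\ne\sigma_{k+1}$ and both faces of $\eta_k$ ($1\le k\le r$); $r$ is its length. It is an $(m,n)$-path sequence if all its simplices are distinct. An $(m,n)$-path sequence is reduced if (i) among $\eta_1,\dots,\eta_r$, $\sigma_1$ is a face only of $\eta_1$ and $\sigma_{r+1}$ is a face only of $\eta_r$; (ii) for each $2\le z\le r$ there is an $(n-1)$-simplex $\sigma'_z$ of $K$ which is a face of both $\eta_{z-1}$ and $\eta_z$ and has $\sigma_z$ as a face, with $\sigma'_x\ne\sigma'_y$ for $2\le x\ne y\le r$. -}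

module Defs where

open import Data.Nat using (ℕ; zero; suc; _≤_; _∸_; _+_)
open import Data.Fin using (Fin)
open import Data.Fin.Subset using (Subset; _⊆_; ∣_∣; ⁅_⁆; Nonempty)
open import Data.Product using (Σ; _×_; ∃)
open import Relation.Binary.PropositionalEquality using (_≡_; _≢_)

-- A simplex on the vertex set Fin V is a subset of Fin V; it is a k-simplex
-- when it has k+1 elements.  A simplicial complex is the predicate saying
-- which subsets are simplices.
record SimplicialComplex (V : ℕ) : Set₁ where
  field
    Simplex      : Subset V → Set
    nonempty     : ∀ {s} → Simplex s → Nonempty s
    singletons   : ∀ (v : Fin V) → Simplex ⁅ v ⁆
    downClosed   : ∀ {s t} → Simplex s → t ⊆ s → Nonempty t → Simplex t
open SimplicialComplex public

IsKSimplex : ∀ {V} → SimplicialComplex V → ℕ → Subset V → Set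
IsKSimplex K k s = Simplex K s × ∣ s ∣ ≡ suc k

HasDim : ∀ {V} → SimplicialComplex V → ℕ → Set
HasDim K n = (∃ λ s → IsKSimplex K n s) × (∀ s → Simplex K s → ∣ s ∣ ≤ suc n)

IsPure : ∀ {V} → SimplicialComplex V → ℕ → Set
IsPure K n = HasDim K n × (∀ s → Simplex K s → ∃ λ η → IsKSimplex K n η × s ⊆ η)

-- An (m,n)-walk sequence σ = σ₁, η₁, σ₂, …, σ_r, η_r, σ_{r+1} = σ',
-- indexed 1-based as in the paper: σs i for 1 ≤ i ≤ r+1, ηs k for 1 ≤ k ≤ r.
-- (Values of σs, ηs outside these ranges are irrelevant.)
record WalkSeq {V} (K : SimplicialComplex V) (m n : ℕ) (σ σ' : Subset V) : Set where
  field
    len     : ℕ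
    σs      : ℕ → Subset V
    ηs      : ℕ → Subset V
    first   : σs 1 ≡ σ
    last    : σs (suc len) ≡ σ'
    σs-simp : ∀ i → 1 ≤ i → i ≤ suc len → IsKSimplex K m (σs i)
    ηs-simp : ∀ k → 1 ≤ k → k ≤ len → IsKSimplex K n (ηs k)
    step-≢  : ∀ k → 1 ≤ k → k ≤ len → σs k ≢ σs (suc k)
    step-l  : ∀ k → 1 ≤ k → k ≤ len → σs k ⊆ ηs k
    step-r  : ∀ k → 1 ≤ k → k ≤ len → σs (suc k) ⊆ ηs k
open WalkSeq public

IsPathSeq : ∀ {V} {K : SimplicialComplex V} {m n σ σ'} → WalkSeq K m n σ σ' → Set
IsPathSeq w =
    (∀ i j → 1 ≤ i → i ≤ suc (len w) → 1 ≤ j → j ≤ suc (len w) →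
       σs w i ≡ σs w j → i ≡ j)
  × (∀ i j → 1 ≤ i → i ≤ len w → 1 ≤ j → j ≤ len w →
       ηs w i ≡ ηs w j → i ≡ j)
  × (∀ i j → 1 ≤ i → i ≤ suc (len w) → 1 ≤ j → j ≤ len w →
       σs w i ≢ ηs w j)

IsReduced : ∀ {V} {K : SimplicialComplex V} {m n σ σ'} → WalkSeq K m n σ σ' → Set
IsReduced {V} {K} {m} {n} w =
    IsPathSeq w
  × (∀ k → 1 ≤ k → k ≤ len w → σs w 1 ⊆ ηs w k → k ≡ 1)
  × (∀ k → 1 ≤ k → k ≤ len w → σs w (suc (len w)) ⊆ ηs w k → k ≡ len w)
  × Σ (ℕ → Subset V) (λ τ →
        (∀ z → 2 ≤ z → z ≤ len w →
           IsKSimplex K (n ∸ 1) (τ z) × τ z ⊆ ηs w (z ∸ 1) × τ z ⊆ ηs w z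
           × σs w z ⊆ τ z)
      × (∀ x y → 2 ≤ x → x ≤ len w → 2 ≤ y → y ≤ len w → τ x ≡ τ y → x ≡ y))

module Submission where

-- A shortest walk is reduced.  If σ_i is a face of η_k for some i ∉ {k, k+1}, then σ_i and
-- one of σ_k, σ_{k+1} are faces of η_k lying at least two steps apart in the walk, and the
-- segment between them can be replaced by the single step through η_k; if those two
-- (n-1)-simplices coincide, the loop between them is cut out instead (the endpoints cannot
-- coincide since σ ≠ σ').  So along a shortest walk σ_i meets η_k only for i ∈ {k, k+1},
-- which forces all σ_i and all η_k to be distinct and gives condition (i); condition (ii)
-- holds with σ'_z := σ_z.

open import Defs
open import Data.Bool using () renaming (_≟_ to _≟ᵇ_)
open import Data.Empty using (⊥-elim)
open import Data.Fin.Subset using (Subset; _⊆_; ∣_∣)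
open import Data.Fin.Subset.Properties using (_⊆?_; ⊆-refl)
open import Data.Nat using (ℕ; zero; suc; _≤_; _<_; _∸_; _+_; z≤n; s≤s; _≤?_; _<?_; _≟_)
open import Data.Nat.Induction using (<-wellFounded)
open import Data.Nat.Properties
open import Data.Product using (Σ; ∃₂; _×_; _,_; proj₁; proj₂)
open import Data.Sum using (_⊎_; inj₁; inj₂)
open import Data.Vec.Properties using (≡-dec)
open import Function using (_∘_)
open import Induction.WellFounded using (module All)
open import Relation.Binary.Construct.On using (wellFounded)
open import Relation.Binary.Definitions using (DecidableEquality; tri<; tri≈; tri>)
open import Relation.Binary.PropositionalEquality
open import Relation.Nullary using (Dec; yes; no; ¬_; contradiction)
open import Relation.Nullary.Decidable using (map′; _×-dec_; _⊎-dec_)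

jump : ℕ → ℕ → ℕ → ℕ
jump p t a with a ≤? p
... | yes _ = a
... | no _ = a + t

module _ {p t : ℕ} where

  jump-≤ : ∀ {a} → a ≤ p → jump p t a ≡ a
  jump-≤ {a} a≤p with a ≤? p
  ... | yes _ = refl
  ... | no a≰p = contradiction a≤p a≰p

  jump-> : ∀ {a} → p < a → jump p t a ≡ a + t
  jump-> {a} p<a with a ≤? p
  ... | yes a≤p = contradiction a≤p (<⇒≱ p<a)
  ... | no _ = refl

  jump-suc : ∀ {k} → k ≢ p → jump p t (suc k) ≡ suc (jump p t k)
  jump-suc {k} k≢p with k ≤? p
  ... | yes k≤p = jump-≤ (≤∧≢⇒< k≤p k≢p)
  ... | no k≰p = jump-> (m<n⇒m<1+n (≰⇒> k≰p))

  m≤jump : ∀ a → a ≤ jump p t a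
  m≤jump a with a ≤? p
  ... | yes _ = ≤-refl
  ... | no _ = m≤m+n a t

  jump-bounded : ∀ {a b} → a ≤ b → jump p t a ≤ b + t
  jump-bounded {a} {b} a≤b with a ≤? p
  ... | yes _ = ≤-trans a≤b (m≤m+n b t)
  ... | no _ = +-monoˡ-≤ t a≤b

_≟ˢ_ : ∀ {V} → DecidableEquality (Subset V)
_≟ˢ_ = ≡-dec _≟ᵇ_

Step : ∀ {V} → (ℕ → Subset V) → (ℕ → Subset V) → ℕ → Set
Step S H k = S k ≢ S (suc k) × S k ⊆ H k × S (suc k) ⊆ H k

module _ {V} {K : SimplicialComplex V} {m n : ℕ} {σ σ' : Subset V} where

  step : (w : WalkSeq K m n σ σ') → ∀ k → 1 ≤ k → k ≤ len w → Step (σs w) (ηs w) k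
  step w k 1≤k k≤r = step-≢ w k 1≤k k≤r , step-l w k 1≤k k≤r , step-r w k 1≤k k≤r

  -- σ_p, η_p, …, σ_{p+t+1} is replaced by σ_p, E, σ_{p+t+1}; jump p t reindexes the σs.
  module _ (w : WalkSeq K m n σ σ') (p t : ℕ) {E : Subset V}
           (1≤p : 1 ≤ p) (p+t≤r : p + t ≤ len w) (E-simp : IsKSimplex K n E)
           (E-step : σs w p ≢ σs w (suc (p + t)) × σs w p ⊆ E × σs w (suc (p + t)) ⊆ E) where

    private
      r = len w
      t≤r = m+n≤o⇒n≤o p p+t≤r
      σs′ = σs w ∘ jump p t
      r′+t≡r = m∸n+n≡m t≤r

      jump-≤r : ∀ {a} → a ≤ r ∸ t → jump p t a ≤ r
      jump-≤r {a} a≤r′ = subst (jump p t a ≤_) r′+t≡r (jump-bounded {a = a} a≤r′)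

      jump-≤1+r : ∀ {a} → a ≤ suc (r ∸ t) → jump p t a ≤ suc r
      jump-≤1+r {a} a≤1+r′ = subst (jump p t a ≤_) (cong suc r′+t≡r) (jump-bounded {a = a} a≤1+r′)

      1≤jump : ∀ {a} → 1 ≤ a → 1 ≤ jump p t a
      1≤jump {a} 1≤a = ≤-trans 1≤a (m≤jump a)

      ηs′ : ℕ → Subset V
      ηs′ k with k ≟ p
      ... | yes _ = E
      ... | no _ = ηs w (jump p t k)

      step′ : ∀ k → 1 ≤ k → k ≤ r ∸ t → Step σs′ ηs′ k
      step′ k 1≤k k≤r′ with k ≟ p
      ... | yes refl rewrite jump-≤ {p} {t} (≤-refl {p}) | jump-> {p} {t} (≤-refl {suc p}) = E-step
      ... | no k≢p rewrite jump-suc {p} {t} k≢p = step w (jump p t k) (1≤jump 1≤k) (jump-≤r k≤r′)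

      ηs′-simp : ∀ k → 1 ≤ k → k ≤ r ∸ t → IsKSimplex K n (ηs′ k)
      ηs′-simp k 1≤k k≤r′ with k ≟ p
      ... | yes _ = E-simp
      ... | no _ = ηs-simp w (jump p t k) (1≤jump 1≤k) (jump-≤r k≤r′)

    splice : WalkSeq K m n σ σ'
    splice = record
      { len = r ∸ t
      ; σs = σs′
      ; ηs = ηs′
      ; first = trans (cong (σs w) (jump-≤ 1≤p)) (first w)
      ; last = trans (cong (σs w) jump-last) (last w)
      ; σs-simp = λ a 1≤a a≤1+r′ → σs-simp w (jump p t a) (1≤jump 1≤a) (jump-≤1+r a≤1+r′)
      ; ηs-simp = ηs′-simp
      ; step-≢ = λ k 1≤k k≤r′ → proj₁ (step′ k 1≤k k≤r′)
      ; step-l = λ k 1≤k k≤r′ → proj₁ (proj₂ (step′ k 1≤k k≤r′))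
      ; step-r = λ k 1≤k k≤r′ → proj₂ (proj₂ (step′ k 1≤k k≤r′))
      }
      where
      jump-last : jump p t (suc (r ∸ t)) ≡ suc r
      jump-last = trans (jump-> (s≤s (m+n≤o⇒m≤o∸n p p+t≤r))) (cong suc r′+t≡r)

  module _ (w : WalkSeq K m n σ σ') where

    private
      r = len w

    Shorter : Set
    Shorter = Σ (WalkSeq K m n σ σ') λ w′ → len w′ < r

    shortcut : ∀ {p q E} → 1 ≤ p → suc p < q → q ≤ suc r → IsKSimplex K n E →
               σs w p ≢ σs w q → σs w p ⊆ E → σs w q ⊆ E → Shorter
    shortcut {p} 1≤p p+1<q q≤1+r E-simp σp≢σq σp⊆E σq⊆E
      with m≤n⇒∃[o]m+o≡n (<⇒≤ p+1<q)
    ... | t , refl =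
      splice w p t 1≤p p+t≤r E-simp (σp≢σq , σp⊆E , σq⊆E) , ∸-monoʳ-< 0<t (m+n≤o⇒n≤o p p+t≤r)
      where
      p+t≤r = ≤-pred q≤1+r
      0<t : 0 < t
      0<t = subst (0 <_) (m+n∸m≡n (suc p) t) (m<n⇒0<n∸m p+1<q)

    repeat⇒shorter : σ ≢ σ' → ∀ {i j} → 1 ≤ i → i < j → j ≤ suc r → σs w i ≡ σs w j → Shorter
    repeat⇒shorter σ≢σ' {j = j} 1≤i i<j j≤1+r σi≡σj with m≤n⇒m<n∨m≡n j≤1+r
    ... | inj₁ (s≤s j≤r) =
      let σj≢σj+1 , σj⊆ηj , σj+1⊆ηj = step w j 1≤j j≤r
      in  shortcut 1≤i (s≤s i<j) (s≤s j≤r) (ηs-simp w j 1≤j j≤r)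
            (σj≢σj+1 ∘ trans (sym σi≡σj)) (subst (_⊆ ηs w j) (sym σi≡σj) σj⊆ηj) σj+1⊆ηj
      where 1≤j = ≤-trans 1≤i (<⇒≤ i<j)
    repeat⇒shorter σ≢σ' {suc zero} _ _ _ σi≡σj | inj₂ refl =
      ⊥-elim (σ≢σ' (trans (sym (first w)) (trans σi≡σj (last w))))
    repeat⇒shorter σ≢σ' {suc k@(suc _)} _ i<j _ σi≡σj | inj₂ refl =
      let σk≢σi , σk⊆ηk , σi⊆ηk = step w k (s≤s z≤n) k≤r
      in  shortcut (s≤s z≤n) i<j ≤-refl (ηs-simp w k (s≤s z≤n) k≤r)
            (λ σk≡σj → σk≢σi (trans σk≡σj (sym σi≡σj))) σk⊆ηk (subst (_⊆ ηs w k) σi≡σj σi⊆ηk)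
      where k≤r = ≤-trans (n≤1+n k) (≤-pred i<j)

    commonCoface⇒shorter : σ ≢ σ' → ∀ {p q E} → 1 ≤ p → suc p < q → q ≤ suc r →
                           IsKSimplex K n E → σs w p ⊆ E → σs w q ⊆ E → Shorter
    commonCoface⇒shorter σ≢σ' {p} {q} 1≤p p+1<q q≤1+r E-simp σp⊆E σq⊆E with σs w p ≟ˢ σs w q
    ... | yes σp≡σq = repeat⇒shorter σ≢σ' 1≤p (<-trans (n<1+n p) p+1<q) q≤1+r σp≡σq
    ... | no σp≢σq = shortcut 1≤p p+1<q q≤1+r E-simp σp≢σq σp⊆E σq⊆E

    -- σ_i lies in η_k although the walk does not pass through η_k at σ_i.
    Chord : ℕ → ℕ → Set
    Chord i k = 1 ≤ i × i ≤ suc r × 1 ≤ k × k ≤ r × σs w i ⊆ ηs w k × (i < k ⊎ suc k < i)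

    chord? : Dec (∃₂ Chord)
    chord? = map′ (λ (i , _ , k , _ , c) → i , k , c)
                  (λ (i , k , c@(_ , i≤1+r , _ , k≤r , _)) → i , s≤s i≤1+r , k , s≤s k≤r , c)
                  (anyUpTo? (λ i → anyUpTo? (chord-at? i) (suc r)) (suc (suc r)))
      where
      chord-at? : ∀ i k → Dec (Chord i k)
      chord-at? i k = 1 ≤? i ×-dec i ≤? suc r ×-dec 1 ≤? k ×-dec k ≤? r ×-dec
                      σs w i ⊆? ηs w k ×-dec (i <? k ⊎-dec suc k <? i)

    chord⇒shorter : σ ≢ σ' → ∃₂ Chord → Shorter
    chord⇒shorter σ≢σ' (i , k , 1≤i , i≤1+r , 1≤k , k≤r , σi⊆ηk , inj₁ i<k) =
      commonCoface⇒shorter σ≢σ' 1≤i (s≤s i<k) (s≤s k≤r) (ηs-simp w k 1≤k k≤r) σi⊆ηk (step-r w k 1≤k k≤r)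
    chord⇒shorter σ≢σ' (i , k , 1≤i , i≤1+r , 1≤k , k≤r , σi⊆ηk , inj₂ k+1<i) =
      commonCoface⇒shorter σ≢σ' 1≤k k+1<i i≤1+r (ηs-simp w k 1≤k k≤r) (step-l w k 1≤k k≤r) σi⊆ηk

    Chordless : Set
    Chordless = ∀ {i k} → 1 ≤ i → i ≤ suc r → 1 ≤ k → k ≤ r → σs w i ⊆ ηs w k → k ≤ i × i ≤ suc k

    ¬chord⇒chordless : ¬ ∃₂ Chord → Chordless
    ¬chord⇒chordless ¬chord {i} {k} 1≤i i≤1+r 1≤k k≤r σi⊆ηk with i <? k ⊎-dec suc k <? i
    ... | yes outside = ⊥-elim (¬chord (i , k , 1≤i , i≤1+r , 1≤k , k≤r , σi⊆ηk , outside))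
    ... | no inside = ≮⇒≥ (inside ∘ inj₁) , ≮⇒≥ (inside ∘ inj₂)

    σs≢ηs : m ≢ n → ∀ i k → 1 ≤ i → i ≤ suc r → 1 ≤ k → k ≤ r → σs w i ≢ ηs w k
    σs≢ηs m≢n i k 1≤i i≤1+r 1≤k k≤r σi≡ηk =
      m≢n (suc-injective (trans (sym (proj₂ (σs-simp w i 1≤i i≤1+r)))
                                (trans (cong ∣_∣ σi≡ηk) (proj₂ (ηs-simp w k 1≤k k≤r)))))

    module _ (chordless : Chordless) where

      <⇒σs≢ : σ ≢ σ' → ∀ {i j} → 1 ≤ i → i < j → j ≤ suc r → σs w i ≢ σs w j
      <⇒σs≢ σ≢σ' {j = j} 1≤i i<j j≤1+r σi≡σj with m≤n⇒m<n∨m≡n j≤1+r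
      ... | inj₁ (s≤s j≤r) =
        <⇒≱ i<j (proj₁ (chordless 1≤i (m≤n⇒m≤1+n (≤-trans (<⇒≤ i<j) j≤r)) 1≤j j≤r
                          (subst (_⊆ ηs w j) (sym σi≡σj) (step-l w j 1≤j j≤r))))
        where 1≤j = ≤-trans 1≤i (<⇒≤ i<j)
      <⇒σs≢ σ≢σ' {suc zero} _ _ _ σi≡σj | inj₂ refl =
        σ≢σ' (trans (sym (first w)) (trans σi≡σj (last w)))
      <⇒σs≢ σ≢σ' {suc k@(suc _)} _ i<j _ σi≡σj | inj₂ refl =
        <⇒≱ i<j (proj₂ (chordless (s≤s z≤n) ≤-refl (s≤s z≤n) k≤r
                          (subst (_⊆ ηs w k) σi≡σj (step-r w k (s≤s z≤n) k≤r))))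
        where k≤r = ≤-trans (n≤1+n k) (≤-pred i<j)

      σs-injective : σ ≢ σ' → ∀ i j → 1 ≤ i → i ≤ suc r → 1 ≤ j → j ≤ suc r → σs w i ≡ σs w j → i ≡ j
      σs-injective σ≢σ' i j 1≤i i≤1+r 1≤j j≤1+r σi≡σj with <-cmp i j
      ... | tri< i<j _ _ = contradiction σi≡σj (<⇒σs≢ σ≢σ' 1≤i i<j j≤1+r)
      ... | tri≈ _ i≡j _ = i≡j
      ... | tri> _ _ j<i = contradiction (sym σi≡σj) (<⇒σs≢ σ≢σ' 1≤j j<i i≤1+r)

      ηs-injective : ∀ i j → 1 ≤ i → i ≤ r → 1 ≤ j → j ≤ r → ηs w i ≡ ηs w j → i ≡ j
      ηs-injective i j 1≤i i≤r 1≤j j≤r ηi≡ηj =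
        ≤-antisym (proj₁ (chordless 1≤j (m≤n⇒m≤1+n j≤r) 1≤i i≤r σj⊆ηi))
                  (proj₁ (chordless 1≤i (m≤n⇒m≤1+n i≤r) 1≤j j≤r σi⊆ηj))
        where
        σj⊆ηi : σs w j ⊆ ηs w i
        σj⊆ηi = subst (σs w j ⊆_) (sym ηi≡ηj) (step-l w j 1≤j j≤r)
        σi⊆ηj : σs w i ⊆ ηs w j
        σi⊆ηj = subst (σs w i ⊆_) ηi≡ηj (step-l w i 1≤i i≤r)

      first-in-first-only : ∀ k → 1 ≤ k → k ≤ r → σs w 1 ⊆ ηs w k → k ≡ 1
      first-in-first-only k 1≤k k≤r σ1⊆ηk = ≤-antisym (proj₁ (chordless ≤-refl (s≤s z≤n) 1≤k k≤r σ1⊆ηk)) 1≤k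

      last-in-last-only : ∀ k → 1 ≤ k → k ≤ r → σs w (suc r) ⊆ ηs w k → k ≡ r
      last-in-last-only k 1≤k k≤r σr+1⊆ηk =
        ≤-antisym k≤r (≤-pred (proj₂ (chordless (s≤s z≤n) ≤-refl 1≤k k≤r σr+1⊆ηk)))

module _ {V} {K : SimplicialComplex V} {n : ℕ} {σ σ' : Subset V} where

  ReducedWalk : Set
  ReducedWalk = Σ (WalkSeq K n (suc n) σ σ') IsReduced

  chordless⇒reduced : σ ≢ σ' → (w : WalkSeq K n (suc n) σ σ') → Chordless w → IsReduced w
  chordless⇒reduced σ≢σ' w chordless =
    (σs-injective w chordless σ≢σ' , ηs-injective w chordless , σs≢ηs w (<⇒≢ (n<1+n n))) ,
    first-in-first-only w chordless ,
    last-in-last-only w chordless ,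
    σs w , faces ,
    λ x y 2≤x x≤r 2≤y y≤r → σs-injective w chordless σ≢σ' x y
      (≤-trans (s≤s z≤n) 2≤x) (m≤n⇒m≤1+n x≤r) (≤-trans (s≤s z≤n) 2≤y) (m≤n⇒m≤1+n y≤r)
    where
    faces : ∀ z → 2 ≤ z → z ≤ len w →
            IsKSimplex K n (σs w z) × σs w z ⊆ ηs w (z ∸ 1) × σs w z ⊆ ηs w z × σs w z ⊆ σs w z
    faces (suc z@(suc _)) _ z+1≤r =
      σs-simp w (suc z) (s≤s z≤n) (m≤n⇒m≤1+n z+1≤r) ,
      step-r w z (s≤s z≤n) (≤-trans (n≤1+n z) z+1≤r) ,
      step-l w (suc z) (s≤s z≤n) z+1≤r ,
      ⊆-refl
    faces (suc zero) (s≤s ()) _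

  reduce : σ ≢ σ' → WalkSeq K n (suc n) σ σ' → ReducedWalk
  reduce σ≢σ' = All.wfRec (wellFounded len <-wellFounded) _ (λ _ → ReducedWalk) reduce-step
    where
    reduce-step : ∀ w → (∀ {w′} → len w′ < len w → ReducedWalk) → ReducedWalk
    reduce-step w reduce-shorter with chord? w
    ... | no ¬chord = w , chordless⇒reduced σ≢σ' w (¬chord⇒chordless w ¬chord)
    ... | yes chord with chord⇒shorter w σ≢σ' chord
    ...   | w′ , w′<w = reduce-shorter {w′} w′<w

lemma3p1 : ∀ {V : ℕ} (K : SimplicialComplex V) (n : ℕ) → 1 ≤ n → IsPure K n →
    (σ σ' : Subset V) → IsKSimplex K (n ∸ 1) σ → IsKSimplex K (n ∸ 1) σ' → σ ≢ σ' →
    WalkSeq K (n ∸ 1) n σ σ' →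
    Σ (WalkSeq K (n ∸ 1) n σ σ') IsReduced
lemma3p1 K (suc n) _ _ σ σ' _ _ σ≢σ' = reduce σ≢σ'
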